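{- Let $\mathrm{sort}$ be a sort function satisfying the characteristic property. For every type $T$, every total preorder $\leq$ on $T$, every predicate $p : T \to \mathrm{bool}$ and every $xs : \mathrm{list}\,T$, we have $\mathrm{filter}\,p\,(\mathrm{sort}_\leq\,xs) = \mathrm{sort}_\leq\,(\mathrm{filter}\,p\,xs)$.
   Context: A total preorder is a relation that is transitive and total. $\mathrm{filter}\,p\,xs$ is the list of the elements of $xs$ satisfying $p$, in their original order. Lists: $[]$ is the empty list, $x :: s$ is cons, $[x]$ is the singleton list, $\mathbin{+\!\!+}$ is concatenation. A "relation" $\leq$ on a type $T$ is a function $T \to T \to \mathrm{bool}$. The merge of two lists w.r.t. $\leq$ is defined by $[] \mathbin{\land\hspace{ -.45em}\land}_\leq ys = ys$, $xs \mathbin{\land\hspace{ -.45em}\land}_\leq [] = xs$, and $(x :: xs) \mathbin{\land\hspace{ -.45em}\land}_\leq (y :: ys) = x :: (xs \mathbin{\land\hspace{ -.45em}\land}_\leq (y :: ys))$ if $x \leq y$, and $= y :: ((x :: xs) \mathbin{\land\hspace{ -.45em}\land}_\leq ys)$ otherwise. A sort function $\mathrm{sort}$ assigns to every type $T$ and relation $\leq$ on $T$ a function $\mathrm{sort}_\leq : \mathrm{list}\,T \to \mathrm{list}\,T$. It satisfies the characteristic property if there is a polymorphic function $\mathrm{asort}$ of type $\forall (T\,R : \mathcal{U}), (R \to R \to R) \to (T \to R) \to R \to \mathrm{list}\,T \to R$ such that: (1) for all $T$, $\leq$, $xs$: $\mathrm{asort}\,(\mathbin{\land\hspace{ -.45em}\land}_\leq)\,(\lambda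 x.[x])\,[]\,xs = \mathrm{sort}_\leq\,xs$; (2) for all $T$, $xs$: $\mathrm{asort}\,(\mathbin{+\!\!+})\,(\lambda x.[x])\,[]\,xs = xs$; (3) $\mathrm{asort}$ is relationally parametric: for all types $T_1,T_2$ and relation $\sim_T \subseteq T_1 \times T_2$, all types $R_1,R_2$ and relation $\sim_R \subseteq R_1\times R_2$, all $m_i : R_i \to R_i \to R_i$ with $a_1 \sim_R a_2 \wedge b_1 \sim_R b_2 \Rightarrow m_1\,a_1\,b_1 \sim_R m_2\,a_2\,b_2$, all $s_i : T_i \to R_i$ with $x_1 \sim_T x_2 \Rightarrow s_1\,x_1 \sim_R s_2\,x_2$, all $e_i : R_i$ with $e_1 \sim_R e_2$, and all lists $xs_1 : \mathrm{list}\,T_1$, $xs_2 : \mathrm{list}\,T_2$ of equal length that are pointwise $\sim_T$-related, we have $\mathrm{asort}\,m_1\,s_1\,e_1\,xs_1 \sim_R \mathrm{asort}\,m_2\,s_2\,e_2\,xs_2$. -}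

module Defs where

open import Data.Bool using (Bool; true; false; if_then_else_)
open import Data.List using (List; []; _∷_; _++_; [_]; length)
open import Data.List.Relation.Binary.Pointwise using (Pointwise)
open import Data.Product using (_×_; Σ)
open import Data.Sum using (_⊎_)
open import Relation.Binary.PropositionalEquality using (_≡_)

Rel : Set → Set
Rel T = T → T → Bool

IsTotalPreorder : {T : Set} → Rel T → Set
IsTotalPreorder {T} _≤_ =
  (∀ x y z → x ≤ y ≡ true → y ≤ z ≡ true → x ≤ z ≡ true) ×
  (∀ x y → (x ≤ y ≡ true) ⊎ (y ≤ x ≡ true))

merge : {T : Set} → Rel T → List T → List T → List T
merge _≤_ [] ys = ys
merge _≤_ (x ∷ xs) ys = go xs ys
  where
  -- go xs' ys' computes (x ∷ xs') merged with ys'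
  go : List _ → List _ → List _
  go xs' [] = x ∷ xs'
  go xs' (y ∷ ys') with x ≤ y
  ... | true  = x ∷ merge _≤_ xs' (y ∷ ys')
  ... | false = y ∷ go xs' ys'

SortFunction : Set₁
SortFunction = (T : Set) → Rel T → List T → List T

ASort : Set₁
ASort = (T R : Set) → (R → R → R) → (T → R) → R → List T → R

Parametric : ASort → Set₁
Parametric asort =
  ∀ (T₁ T₂ : Set) (∼T : T₁ → T₂ → Set)
    (R₁ R₂ : Set) (∼R : R₁ → R₂ → Set)
    (m₁ : R₁ → R₁ → R₁) (m₂ : R₂ → R₂ → R₂) →
    (∀ a₁ a₂ b₁ b₂ → ∼R a₁ a₂ → ∼R b₁ b₂ → ∼R (m₁ a₁ b₁) (m₂ a₂ b₂)) →
    (s₁ : T₁ → R₁) (s₂ : T₂ → R₂) →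
    (∀ x₁ x₂ → ∼T x₁ x₂ → ∼R (s₁ x₁) (s₂ x₂)) →
    (e₁ : R₁) (e₂ : R₂) → ∼R e₁ e₂ →
    (xs₁ : List T₁) (xs₂ : List T₂) → Pointwise ∼T xs₁ xs₂ →
    ∼R (asort T₁ R₁ m₁ s₁ e₁ xs₁) (asort T₂ R₂ m₂ s₂ e₂ xs₂)

CharacteristicProperty : SortFunction → Set₁
CharacteristicProperty sort =
  Σ ASort λ asort →
    (∀ (T : Set) (_≤_ : Rel T) (xs : List T) →
       asort T (List T) (merge _≤_) [_] [] xs ≡ sort T _≤_ xs) ×
    (∀ (T : Set) (xs : List T) →
       asort T (List T) _++_ [_] [] xs ≡ xs) ×
    Parametric asort

-- Parametricity applied to the relation  b ≡ insertionSort a  between the (++)-instance and the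
-- merge-instance of asort shows that every sort function with the characteristic property is
-- insertion sort. The only nontrivial obligation is that merging two insertion-sorted lists gives
-- the insertion sort of their concatenation: merging a sorted list into bs inserts its elements
-- one by one, and inserting the elements of insertionSort as gives the same result as inserting
-- those of as, because two insertions commute unless the elements are tied, and insertion sort
-- keeps tied elements in their original order.
module Submission where

open import Defs
open import Data.Bool using (Bool; true; false)
open import Data.List using (List; []; _∷_; _++_; [_]; foldr; filterᵇ)
open import Data.List.Properties using (foldr-++)
open import Data.List.Relation.Unary.All using (All; []; _∷_)
open import Data.List.Relation.Unary.All.Properties using (filter⁺)
open import Data.List.Relation.Unary.AllPairs using (AllPairs; []; _∷_)
import Data.List.Relation.Binary.Pointwise as Pointwise
open import Data.Product using (_,_; proj₁; proj₂)
open import Data.Sum using (_⊎_; inj₁; inj₂)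
open import Function using (_∘_)
open import Relation.Nullary.Decidable using (T?)
open import Relation.Binary.PropositionalEquality
  using (_≡_; refl; sym; trans; cong; module ≡-Reasoning)

true-or-false : ∀ b → b ≡ true ⊎ b ≡ false
true-or-false true  = inj₁ refl
true-or-false false = inj₂ refl

module InsertionSort {T : Set} (_≤_ : Rel T) where

  open ≡-Reasoning

  insert : T → List T → List T
  insert x [] = [ x ]
  insert x (y ∷ ys) with x ≤ y
  ... | true  = x ∷ y ∷ ys
  ... | false = y ∷ insert x ys

  insertionSort : List T → List T
  insertionSort = foldr insert []

  _≼_ : T → T → Set
  x ≼ y = x ≤ y ≡ true

  Sorted : List T → Set
  Sorted = AllPairs _≼_

  insert-≤ : ∀ {x y} ys → x ≼ y → insert x (y ∷ ys) ≡ x ∷ y ∷ ys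
  insert-≤ {x} {y} ys x≤y rewrite x≤y = refl

  insert-≰ : ∀ {x y} ys → x ≤ y ≡ false → insert x (y ∷ ys) ≡ y ∷ insert x ys
  insert-≰ {x} {y} ys x≰y rewrite x≰y = refl

  merge-≤ : ∀ {x y} xs ys → x ≼ y →
            merge _≤_ (x ∷ xs) (y ∷ ys) ≡ x ∷ merge _≤_ xs (y ∷ ys)
  merge-≤ {x} {y} xs ys x≤y rewrite x≤y = refl

  merge-≰ : ∀ {x y} xs ys → x ≤ y ≡ false →
            merge _≤_ (x ∷ xs) (y ∷ ys) ≡ y ∷ merge _≤_ (x ∷ xs) ys
  merge-≰ {x} {y} xs ys x≰y rewrite x≰y = refl

  merge-[]ʳ : ∀ xs → merge _≤_ xs [] ≡ xs
  merge-[]ʳ []       = refl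
  merge-[]ʳ (x ∷ xs) = refl

  module TotalPreorderProperties (isTotalPreorder : IsTotalPreorder _≤_) where

    ≤-trans : ∀ {x y z} → x ≼ y → y ≼ z → x ≼ z
    ≤-trans = proj₁ isTotalPreorder _ _ _

    ≰⇒≥ : ∀ {x y} → x ≤ y ≡ false → y ≼ x
    ≰⇒≥ {x} {y} x≰y with proj₂ isTotalPreorder x y
    ... | inj₂ y≤x = y≤x
    ... | inj₁ x≤y with trans (sym x≰y) x≤y
    ...   | ()

    ≤-≰-trans : ∀ {x y z} → x ≼ y → x ≤ z ≡ false → y ≤ z ≡ false
    ≤-≰-trans {y = y} {z = z} x≤y x≰z with y ≤ z in y≤z
    ... | false = refl
    ... | true with trans (sym x≰z) (≤-trans x≤y y≤z)
    ...   | ()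

    All-≤-trans : ∀ {x y zs} → x ≼ y → All (y ≼_) zs → All (x ≼_) zs
    All-≤-trans x≤y []           = []
    All-≤-trans x≤y (y≤z ∷ y≤zs) = ≤-trans x≤y y≤z ∷ All-≤-trans x≤y y≤zs

    insert-lowerBound : ∀ {x} ys → All (x ≼_) ys → insert x ys ≡ x ∷ ys
    insert-lowerBound []       []         = refl
    insert-lowerBound (y ∷ ys) (x≤y ∷ _) = insert-≤ ys x≤y

    insert⁺ : ∀ {y x} zs → y ≼ x → All (y ≼_) zs → All (y ≼_) (insert x zs)
    insert⁺ []               y≤x []            = y≤x ∷ []
    insert⁺ {x = x} (z ∷ zs) y≤x (y≤z ∷ y≤zs) with x ≤ z
    ... | true  = y≤x ∷ y≤z ∷ y≤zs
    ... | false = y≤z ∷ insert⁺ zs y≤x y≤zs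

    insert-sorted : ∀ x {zs} → Sorted zs → Sorted (insert x zs)
    insert-sorted x []                     = [] ∷ []
    insert-sorted x {z ∷ zs} (z≤zs ∷ sorted) with x ≤ z in x≤z
    ... | true  = (x≤z ∷ All-≤-trans x≤z z≤zs) ∷ z≤zs ∷ sorted
    ... | false = insert⁺ zs (≰⇒≥ x≤z) z≤zs ∷ insert-sorted x sorted

    insertionSort-sorted : ∀ xs → Sorted (insertionSort xs)
    insertionSort-sorted []       = []
    insertionSort-sorted (x ∷ xs) = insert-sorted x (insertionSort-sorted xs)

    insert-comm : ∀ {x y} zs → x ≤ y ≡ false → insert x (insert y zs) ≡ insert y (insert x zs)
    insert-comm [] x≰y =
      trans (insert-≰ [] x≰y) (sym (insert-≤ [] (≰⇒≥ x≰y)))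
    insert-comm {x} {y} (z ∷ zs) x≰y with y ≤ z in y≤z | x ≤ z in x≤z
    ... | true  | true  = begin
      insert x (y ∷ z ∷ zs) ≡⟨ insert-≰ (z ∷ zs) x≰y ⟩
      y ∷ insert x (z ∷ zs) ≡⟨ cong (y ∷_) (insert-≤ zs x≤z) ⟩
      y ∷ x ∷ z ∷ zs        ≡⟨ insert-≤ (z ∷ zs) (≰⇒≥ x≰y) ⟨
      insert y (x ∷ z ∷ zs) ∎
    ... | true  | false = begin
      insert x (y ∷ z ∷ zs)      ≡⟨ insert-≰ (z ∷ zs) x≰y ⟩
      y ∷ insert x (z ∷ zs)      ≡⟨ cong (y ∷_) (insert-≰ zs x≤z) ⟩
      y ∷ z ∷ insert x zs        ≡⟨ insert-≤ (insert x zs) y≤z ⟨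
      insert y (z ∷ insert x zs) ∎
    ... | false | true  with trans (sym y≤z) (≤-trans (≰⇒≥ x≰y) x≤z)
    ...   | ()
    insert-comm {x} {y} (z ∷ zs) x≰y | false | false = begin
      insert x (z ∷ insert y zs) ≡⟨ insert-≰ (insert y zs) x≤z ⟩
      z ∷ insert x (insert y zs) ≡⟨ cong (z ∷_) (insert-comm zs x≰y) ⟩
      z ∷ insert y (insert x zs) ≡⟨ insert-≰ (insert x zs) y≤z ⟨
      insert y (z ∷ insert x zs) ∎

    foldr-insert-insert : ∀ bs x cs →
      foldr insert bs (insert x cs) ≡ insert x (foldr insert bs cs)
    foldr-insert-insert bs x [] = refl
    foldr-insert-insert bs x (y ∷ cs) with x ≤ y in x≤y
    ... | true  = refl
    ... | false = begin
      insert y (foldr insert bs (insert x cs)) ≡⟨ cong (insert y) (foldr-insert-insert bs x cs) ⟩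
      insert y (insert x (foldr insert bs cs)) ≡⟨ insert-comm (foldr insert bs cs) x≤y ⟨
      insert x (insert y (foldr insert bs cs)) ∎

    foldr-insert-insertionSort : ∀ bs as →
      foldr insert bs (insertionSort as) ≡ foldr insert bs as
    foldr-insert-insertionSort bs []       = refl
    foldr-insert-insertionSort bs (a ∷ as) =
      trans (foldr-insert-insert bs a (insertionSort as))
            (cong (insert a) (foldr-insert-insertionSort bs as))

    insert-merge-≤ : ∀ {x a y} as bs → x ≼ a → x ≼ y →
      insert x (merge _≤_ (a ∷ as) (y ∷ bs)) ≡ x ∷ merge _≤_ (a ∷ as) (y ∷ bs)
    insert-merge-≤ {x} {a} {y} as bs x≤a x≤y with true-or-false (a ≤ y)
    ... | inj₁ a≤y = begin
      insert x (merge _≤_ (a ∷ as) (y ∷ bs)) ≡⟨ cong (insert x) (merge-≤ as bs a≤y) ⟩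
      insert x (a ∷ merge _≤_ as (y ∷ bs))   ≡⟨ insert-≤ _ x≤a ⟩
      x ∷ a ∷ merge _≤_ as (y ∷ bs)          ≡⟨ cong (x ∷_) (merge-≤ as bs a≤y) ⟨
      x ∷ merge _≤_ (a ∷ as) (y ∷ bs)        ∎
    ... | inj₂ a≰y = begin
      insert x (merge _≤_ (a ∷ as) (y ∷ bs)) ≡⟨ cong (insert x) (merge-≰ as bs a≰y) ⟩
      insert x (y ∷ merge _≤_ (a ∷ as) bs)   ≡⟨ insert-≤ _ x≤y ⟩
      x ∷ y ∷ merge _≤_ (a ∷ as) bs          ≡⟨ cong (x ∷_) (merge-≰ as bs a≰y) ⟨
      x ∷ merge _≤_ (a ∷ as) (y ∷ bs)        ∎

    merge-lowerBound : ∀ {x} as bs → All (x ≼_) as →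
      merge _≤_ (x ∷ as) bs ≡ insert x (merge _≤_ as bs)
    merge-lowerBound as [] x≤as =
      trans (sym (insert-lowerBound as x≤as)) (cong (insert _) (sym (merge-[]ʳ as)))
    merge-lowerBound {x} [] (y ∷ bs) [] with x ≤ y
    ... | true  = refl
    ... | false = cong (y ∷_) (merge-lowerBound [] bs [])
    merge-lowerBound {x} (a ∷ as) (y ∷ bs) (x≤a ∷ x≤as) with true-or-false (x ≤ y)
    ... | inj₁ x≤y = trans (merge-≤ (a ∷ as) bs x≤y) (sym (insert-merge-≤ as bs x≤a x≤y))
    ... | inj₂ x≰y = begin
      merge _≤_ (x ∷ a ∷ as) (y ∷ bs)        ≡⟨ merge-≰ (a ∷ as) bs x≰y ⟩
      y ∷ merge _≤_ (x ∷ a ∷ as) bs          ≡⟨ cong (y ∷_) (merge-lowerBound (a ∷ as) bs (x≤a ∷ x≤as)) ⟩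
      y ∷ insert x (merge _≤_ (a ∷ as) bs)   ≡⟨ insert-≰ _ x≰y ⟨
      insert x (y ∷ merge _≤_ (a ∷ as) bs)   ≡⟨ cong (insert x) (merge-≰ as bs (≤-≰-trans x≤a x≰y)) ⟨
      insert x (merge _≤_ (a ∷ as) (y ∷ bs)) ∎

    merge-sorted : ∀ {as} bs → Sorted as → merge _≤_ as bs ≡ foldr insert bs as
    merge-sorted bs []                       = refl
    merge-sorted {a ∷ as} bs (a≤as ∷ sorted) =
      trans (merge-lowerBound as bs a≤as) (cong (insert a) (merge-sorted bs sorted))

    merge-insertionSort : ∀ as bs →
      merge _≤_ (insertionSort as) (insertionSort bs) ≡ insertionSort (as ++ bs)
    merge-insertionSort as bs = begin
      merge _≤_ (insertionSort as) (insertionSort bs)    ≡⟨ merge-sorted _ (insertionSort-sorted as) ⟩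
      foldr insert (insertionSort bs) (insertionSort as) ≡⟨ foldr-insert-insertionSort _ as ⟩
      foldr insert (insertionSort bs) as                 ≡⟨ foldr-++ insert [] as bs ⟨
      insertionSort (as ++ bs)                           ∎

    module _ (p : T → Bool) where

      filter-insert-reject : ∀ {x} ys → p x ≡ false →
        filterᵇ p (insert x ys) ≡ filterᵇ p ys
      filter-insert-reject {x} [] px rewrite px = refl
      filter-insert-reject {x} (y ∷ ys) px with x ≤ y
      ... | true rewrite px = refl
      ... | false with p y
      ...   | true  = cong (y ∷_) (filter-insert-reject ys px)
      ...   | false = filter-insert-reject ys px

      filter-insert-accept : ∀ {x ys} → Sorted ys → p x ≡ true →
        filterᵇ p (insert x ys) ≡ insert x (filterᵇ p ys)
      filter-insert-accept {x} [] px rewrite px = refl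
      filter-insert-accept {x} {y ∷ ys} (y≤ys ∷ sorted) px with x ≤ y in x≤y
      ... | true rewrite px =
        sym (insert-lowerBound _ (filter⁺ (T? ∘ p) (x≤y ∷ All-≤-trans x≤y y≤ys)))
      ... | false with p y
      ...   | true  = trans (cong (y ∷_) (filter-insert-accept sorted px))
                            (sym (insert-≰ (filterᵇ p ys) x≤y))
      ...   | false = filter-insert-accept sorted px

      filter-insertionSort : ∀ xs → filterᵇ p (insertionSort xs) ≡ insertionSort (filterᵇ p xs)
      filter-insertionSort []       = refl
      filter-insertionSort (x ∷ xs) with p x in px
      ... | true  = trans (filter-insert-accept (insertionSort-sorted xs) px)
                          (cong (insert x) (filter-insertionSort xs))
      ... | false = trans (filter-insert-reject (insertionSort xs) px) (filter-insertionSort xs)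

open InsertionSort using (insertionSort)
open InsertionSort.TotalPreorderProperties using (merge-insertionSort; filter-insertionSort)

sort≡insertionSort : (sort : SortFunction) → CharacteristicProperty sort →
  ∀ (T : Set) (_≤_ : Rel T) → IsTotalPreorder _≤_ →
  ∀ xs → sort T _≤_ xs ≡ insertionSort _≤_ xs
sort≡insertionSort sort (asort , asort-merge , asort-++ , parametric) T _≤_ isTotalPreorder xs =
  begin
    sort T _≤_ xs                                       ≡⟨ asort-merge T _≤_ xs ⟨
    asort T (List T) (merge _≤_) [_] [] xs              ≡⟨ related ⟩
    insertionSort _≤_ (asort T (List T) _++_ [_] [] xs) ≡⟨ cong (insertionSort _≤_) (asort-++ T xs) ⟩
    insertionSort _≤_ xs                                ∎
  where
  open ≡-Reasoning

  _∼_ : List T → List T → Set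
  as ∼ bs = bs ≡ insertionSort _≤_ as

  ++-merge-related : ∀ as₁ as₂ bs₁ bs₂ → as₁ ∼ as₂ → bs₁ ∼ bs₂ → (as₁ ++ bs₁) ∼ merge _≤_ as₂ bs₂
  ++-merge-related as₁ _ bs₁ _ refl refl = merge-insertionSort _≤_ isTotalPreorder as₁ bs₁

  singleton-related : ∀ x₁ x₂ → x₁ ≡ x₂ → [ x₁ ] ∼ [ x₂ ]
  singleton-related x _ refl = refl

  related : asort T (List T) (merge _≤_) [_] [] xs ≡ insertionSort _≤_ (asort T (List T) _++_ [_] [] xs)
  related = parametric T T _≡_ (List T) (List T) _∼_ _++_ (merge _≤_) ++-merge-related
              [_] [_] singleton-related [] [] refl xs xs (Pointwise.refl refl)

theorem3p16 : (sort : SortFunction) → CharacteristicProperty sort →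
    ∀ (T : Set) (_≤_ : Rel T) → IsTotalPreorder _≤_ →
    ∀ (p : T → Bool) (xs : List T) →
    filterᵇ p (sort T _≤_ xs) ≡ sort T _≤_ (filterᵇ p xs)
theorem3p16 sort characteristic T _≤_ isTotalPreorder p xs = begin
  filterᵇ p (sort T _≤_ xs)        ≡⟨ cong (filterᵇ p) (sort≡insertionSort′ xs) ⟩
  filterᵇ p (insertionSort _≤_ xs) ≡⟨ filter-insertionSort _≤_ isTotalPreorder p xs ⟩
  insertionSort _≤_ (filterᵇ p xs) ≡⟨ sort≡insertionSort′ (filterᵇ p xs) ⟨
  sort T _≤_ (filterᵇ p xs)        ∎
  where
  open ≡-Reasoning
  sort≡insertionSort′ : ∀ ys → sort T _≤_ ys ≡ insertionSort _≤_ ys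
  sort≡insertionSort′ = sort≡insertionSort sort characteristic T _≤_ isTotalPreorder
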